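{- Let $X$ and $S$ be sets and $r\subseteq X\times S$ a binary relation. Then the greatest saturation on $S$ compatible with the reduction $rr^*$ is $r^{ -*}r^-$, i.e. $\mathbb{A}(rr^*)=r^{ -*}r^-$; in other words the basic topology $(S,r^{ -*}r^-,rr^*)$ is reduced.
   Context: All reasoning is intuitionistic (no law of excluded middle). Write $x\,r\,a$ for $(x,a)\in r$. For $D\subseteq X$ and $U\subseteq S$: $r(D)=\{a\in S\mid \exists x\in D,\ x\,r\,a\}$, $r^-(U)=\{x\in X\mid \exists a\in U,\ x\,r\,a\}$, $r^*(U)=\{x\in X\mid r(\{x\})\subseteq U\}$, $r^{ -*}(D)=\{a\in S\mid r^-(\{a\})\subseteq D\}$. For $U,V\subseteq S$, $U\between V$ means there exists $a\in U\cap V$. For operators $\mathcal{O},\mathcal{O}':\mathrm{Pow}(S)\to\mathrm{Pow}(S)$, $\mathcal{O}\triangleleft\mathcal{O}'$ means: for all $U,V\subseteq S$, $\mathcal{O}(U)\between\mathcal{O}'(V)$ implies $U\between\mathcal{O}'(V)$. A saturation is a monotone idempotent operator $\mathcal{A}$ with $U\subseteq\mathcal{A}(U)$ for all $U$; a reduction is a monotone idempotent operator $\mathcal{J}$ with $\mathcal{J}(U)\subseteq U$ for all $U$; $rr^*$ is a reduction and $r^{ -*}r^-$ a saturation on $S$. For a reduction $\mathcal{J}$, $\mathbb{A}(\mathcal{J})$ denotes the greatest saturation $\mathcal{A}$ (w.r.t. pointwise inclusion) with $\mathcal{A}\triangleleft\mathcal{J}$. -}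

module Defs where

open import Level using (Level; suc; _⊔_)
open import Data.Product using (Σ; _×_; ∃; _,_)
open import Relation.Unary using (Pred; _⊆_; _∈_)

-- Subsets of a set A (at level ℓ) are predicates  A → Set ℓ  (Pred A ℓ).
-- A binary relation r ⊆ X × S is  X → S → Set ℓ ; "x r a" is  r x a.

module _ {ℓ : Level} {X S : Set ℓ} (r : X → S → Set ℓ) where

  rImg : Pred X ℓ → Pred S ℓ
  rImg D a = Σ X λ x → D x × r x a

  rInv : Pred S ℓ → Pred X ℓ
  rInv U x = Σ S λ a → U a × r x a

  rStar : Pred S ℓ → Pred X ℓ
  rStar U x = ∀ a → r x a → U a

  rInvStar : Pred X ℓ → Pred S ℓ
  rInvStar D a = ∀ x → r x a → D x

  rrStar : Pred S ℓ → Pred S ℓ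
  rrStar U = rImg (rStar U)

  rInvStarrInv : Pred S ℓ → Pred S ℓ
  rInvStarrInv U = rInvStar (rInv U)

module _ {ℓ : Level} {S : Set ℓ} where

  Op : Set (suc ℓ)
  Op = Pred S ℓ → Pred S ℓ

  _≬_ : Pred S ℓ → Pred S ℓ → Set ℓ
  U ≬ V = Σ S λ a → U a × V a

  _⊑_ : Op → Op → Set (suc ℓ)
  O ⊑ O' = ∀ (U : Pred S ℓ) → O U ⊆ O' U

  _◁_ : Op → Op → Set (suc ℓ)
  O ◁ O' = ∀ (U V : Pred S ℓ) → O U ≬ O' V → U ≬ O' V

  Monotone : Op → Set (suc ℓ)
  Monotone O = ∀ (U V : Pred S ℓ) → U ⊆ V → O U ⊆ O V

  Idempotent : Op → Set (suc ℓ)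
  Idempotent O = ∀ (U : Pred S ℓ) → O (O U) ⊆ O U × O U ⊆ O (O U)

  record IsSaturation (A : Op) : Set (suc ℓ) where
    field
      monotone   : Monotone A
      idempotent : Idempotent A
      reflexive  : ∀ (U : Pred S ℓ) → U ⊆ A U

  record IsReduction (J : Op) : Set (suc ℓ) where
    field
      monotone   : Monotone J
      idempotent : Idempotent J
      coreflexive : ∀ (U : Pred S ℓ) → J U ⊆ U

  record IsGreatestCompatibleSaturation (J A : Op) : Set (suc ℓ) where
    field
      saturation : IsSaturation A
      compatible : A ◁ J
      greatest   : ∀ (A' : Op) → IsSaturation A' → A' ◁ J → A' ⊑ A

module Submission where

open import Defs
open import Level using (Level)
open import Data.Product using (_,_)
open import Relation.Unary using (Pred; _⊆_)

-- r⁻ ⊣ r⁻* is a Galois connection, so r⁻*r⁻ is a saturation, and the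
-- counit r⁻ r⁻* ⊆ id gives compatibility with rr*.  For maximality, let A be
-- any operator with A ◁ rr*, and let a ∈ A(U) with x r a.  Test compatibility
-- against V = r({x}): x ∈ r*(V), so a ∈ A(U) ∩ rr*(V), hence some b ∈ U lies
-- in rr*(V) ⊆ V, i.e. x r b.  This puts a in r⁻*r⁻(U).

module _ {ℓ : Level} {X S : Set ℓ} (r : X → S → Set ℓ) where

  rInv⊆⇒⊆rInvStar : (U : Pred S ℓ) (D : Pred X ℓ) →
    rInv r U ⊆ D → U ⊆ rInvStar r D
  rInv⊆⇒⊆rInvStar U D r⁻U⊆D {a} aU x xra = r⁻U⊆D (a , aU , xra)

  rInv-rInvStar-counit : (D : Pred X ℓ) → rInv r (rInvStar r D) ⊆ D
  rInv-rInvStar-counit D {x} (a , aD , xra) = aD x xra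

  rInv-monotone : (U V : Pred S ℓ) → U ⊆ V → rInv r U ⊆ rInv r V
  rInv-monotone U V U⊆V (a , aU , xra) = a , U⊆V aU , xra

  rInvStarrInv-inflationary : (U : Pred S ℓ) → U ⊆ rInvStarrInv r U
  rInvStarrInv-inflationary U = rInv⊆⇒⊆rInvStar U (rInv r U) λ x∈r⁻U → x∈r⁻U

  rInvStarrInv-monotone : Monotone (rInvStarrInv r)
  rInvStarrInv-monotone U V U⊆V = rInv⊆⇒⊆rInvStar _ (rInv r V) λ x∈r⁻r⁻*r⁻U →
    rInv-monotone U V U⊆V (rInv-rInvStar-counit (rInv r U) x∈r⁻r⁻*r⁻U)

  rInvStarrInv-idempotent : Idempotent (rInvStarrInv r)
  rInvStarrInv-idempotent U =
      rInv⊆⇒⊆rInvStar _ (rInv r U) (λ x∈r⁻r⁻*r⁻r⁻*r⁻U →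
        rInv-rInvStar-counit (rInv r U)
          (rInv-rInvStar-counit (rInv r (rInvStarrInv r U)) x∈r⁻r⁻*r⁻r⁻*r⁻U))
    , rInvStarrInv-inflationary (rInvStarrInv r U)

  rInvStarrInv-isSaturation : IsSaturation (rInvStarrInv r)
  rInvStarrInv-isSaturation = record
    { monotone   = rInvStarrInv-monotone
    ; idempotent = rInvStarrInv-idempotent
    ; reflexive  = rInvStarrInv-inflationary
    }

  rrStar-coreflexive : (U : Pred S ℓ) → rrStar r U ⊆ U
  rrStar-coreflexive U (x , xr*U , xra) = xr*U _ xra

  rStar-image : (x : X) → rStar r (r x) x
  rStar-image x a xra = xra

  rInvStarrInv-◁-rrStar : rInvStarrInv r ◁ rrStar r
  rInvStarrInv-◁-rrStar U V (a , ar⁻*r⁻U , (x , xr*V , xra)) =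
    let (b , bU , xrb) = rInv-rInvStar-counit (rInv r U) (a , ar⁻*r⁻U , xra)
    in b , bU , (x , xr*V , xrb)

  ◁-rrStar⇒⊑rInvStarrInv : (A : Pred S ℓ → Pred S ℓ) →
    A ◁ rrStar r → A ⊑ rInvStarrInv r
  ◁-rrStar⇒⊑rInvStarrInv A A◁rr* U {a} aAU x xra =
    let (b , bU , brr*rx) = A◁rr* U (r x) (a , aAU , (x , rStar-image x , xra))
    in b , bU , rrStar-coreflexive (r x) brr*rx

proposition5p2 : {ℓ : Level} {X S : Set ℓ} (r : X → S → Set ℓ) →
    IsGreatestCompatibleSaturation (rrStar r) (rInvStarrInv r)
proposition5p2 r = record
  { saturation = rInvStarrInv-isSaturation r
  ; compatible = rInvStarrInv-◁-rrStar r
  ; greatest   = λ A _ → ◁-rrStar⇒⊑rInvStarrInv r A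
  }
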